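{- Let $s\geq 2$ and $n\geq 2s$ be integers with $\gcd(n,s)=1$. The circulant graph $\mathrm{circ}(n;\pm1,\pm s)$ is $2$-spanning cyclable if and only if $n\geq 6$.
   Context: $\mathrm{circ}(n;\pm1,\pm s)$ is the Cayley graph on $\mathbb{Z}/n\mathbb{Z}$ with connection set $\{\pm1,\pm s\}$: vertices $u_0,\dots,u_{n-1}$ (indices mod $n$), with $u_i$ adjacent to $u_{i\pm1}$ and $u_{i\pm s}$. A 2-factor of a graph is a spanning subgraph in which every vertex has valency 2; it separates a set $A$ of $k$ vertices if it consists of exactly $k$ cycles and $A$ meets the vertex set of each cycle in exactly one vertex. A graph $X$ is $k$-spanning cyclable if for every $A\subseteq V(X)$ with $|A|=k$ there is a 2-factor of $X$ separating $A$. -}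

module Defs where

open import Data.Nat using (ℕ; zero; suc; _+_; _≤_)
open import Data.Nat.DivMod using (_%_)
open import Data.Fin using (Fin; toℕ)
open import Data.List using (List; []; _∷_; _++_; [_]; length; concat; allFin)
open import Data.List.Membership.Propositional using (_∈_)
open import Data.List.Relation.Unary.Unique.Propositional using (Unique)
open import Data.List.Relation.Unary.Linked using (Linked)
open import Data.List.Relation.Unary.All using (All)
open import Data.List.Relation.Binary.Permutation.Propositional using (_↭_)
open import Data.Product using (Σ; _×_; ∃)
open import Data.Sum using (_⊎_)
open import Relation.Binary.PropositionalEquality using (_≡_)

StepBy : (n d : ℕ) → Fin n → Fin n → Set
StepBy zero    d () v
StepBy (suc m) d u  v = (toℕ u + d) % suc m ≡ toℕ v

circAdj : (n s : ℕ) → Fin n → Fin n → Set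
circAdj n s u v = StepBy n 1 u v ⊎ StepBy n 1 v u ⊎ StepBy n s u v ⊎ StepBy n s v u

close : {A : Set} → List A → List A
close []       = []
close (x ∷ xs) = x ∷ (xs ++ [ x ])

IsCycle : (n s : ℕ) → List (Fin n) → Set
IsCycle n s c = (3 ≤ length c) × Unique c × Linked (circAdj n s) (close c)

Is2Factor : (n s : ℕ) → List (List (Fin n)) → Set
Is2Factor n s cs = All (IsCycle n s) cs × (concat cs ↭ allFin n)

MeetsOnce : {n : ℕ} → List (Fin n) → List (Fin n) → Set
MeetsOnce A c =
  Σ _ (λ a → (a ∈ A) × (a ∈ c)) ×
  (∀ {a b} → a ∈ A → a ∈ c → b ∈ A → b ∈ c → a ≡ b)

Separates : {n : ℕ} → List (List (Fin n)) → List (Fin n) → Set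
Separates cs A = (length cs ≡ length A) × All (MeetsOnce A) cs

SpanningCyclable : (k n s : ℕ) → Set
SpanningCyclable k n s =
  (A : List (Fin n)) → Unique A → length A ≡ k →
  ∃ λ cs → Is2Factor n s cs × Separates cs A

-- Necessity: a 2-factor separating two vertices consists of two cycles, each with at least
-- three vertices.  Sufficiency: it is enough to find a spanning copy of circ(n;±1,±t) with
-- 3 ≤ t and 2t < n, i.e. a labelling v of the vertices by ℤ/n with v(i) adjacent to v(i+1)
-- and to v(i+t).  For s ≥ 3 the identity labelling with t = s works, since coprimality rules
-- out n = 2s; for s = 2, n is odd and v(i) = 2i with n = 2t + 1 works.  In such a copy the
-- offsets 0, 1, t+1, t carry a 4-cycle and the remaining offsets carry a second cycle, and the
-- rotations of this 2-factor separate every pair of vertices.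
module Submission where

open import Defs
open import Data.Nat using (ℕ; zero; suc; _+_; _*_; _⊓_; _≤_; _<_; _≟_; s≤s; s≤s⁻¹; z≤n; NonZero)
open import Data.Nat.Properties
open import Data.Nat.DivMod
  using (_%_; _/_; _mod_; %-congˡ; %-distribˡ-+; %-distribˡ-*; m%n%n≡m%n; m%n<n;
         [m+n]%n≡m%n; [m+kn]%n≡m%n; m<n⇒m%n≡m; m≡m%n+[m/n]*n)
open import Data.Nat.Divisibility using (divides; ∣-refl)
open import Data.Nat.Coprimality using (Coprime; gcd≡1⇒coprime)
open import Data.Nat.GCD using (gcd)
open import Data.Nat.Tactic.RingSolver using (solve-∀)
open import Data.Fin using (Fin; toℕ)
open import Data.Fin.Properties using (toℕ-injective; toℕ-fromℕ<; toℕ<n)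
open import Data.List
  using (List; []; _∷_; _∷ʳ_; _++_; [_]; map; length; concat; take; allFin; upTo; applyUpTo; applyDownFrom; last)
open import Data.List.Properties
  using (++-assoc; ++-identityʳ; map-++; map-upTo; length-++; length-map; length-take; length-tabulate;
         length-applyUpTo; length-applyDownFrom; applyUpTo-∷ʳ; reverse-applyUpTo)
open import Data.List.Membership.Propositional using (_∈_; _∉_)
open import Data.List.Membership.Propositional.Properties
  using (∈-map⁺; ∈-++⁺ˡ; ∈-++⁺ʳ; ∈-++⁻; ∈-allFin; ∈-upTo⁺; ∈-applyUpTo⁺; ∈-applyUpTo⁻)
open import Data.List.Membership.Propositional.Properties.WithK using (unique∧set⇒bag)
open import Data.List.Relation.Binary.BagAndSetEquality using (∼bag⇒↭)
open import Data.List.Relation.Binary.Permutation.Propositional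
  using (_↭_; ↭-refl; ↭-sym; ↭-trans; ↭-reflexive; ↭-prep; ↭-swap; module PermutationReasoning; ↭⇒↭ₛ)
open import Data.List.Relation.Binary.Permutation.Propositional.Properties
  using (∈-resp-↭; ∷↭∷ʳ; ++-comm; ++⁺ʳ; ↭-reverse; ↭-length; map⁺)
import Data.List.Relation.Binary.Permutation.Setoid.Properties as Permutationₛ
open import Data.List.Relation.Unary.Any using (here; there)
open import Data.List.Relation.Unary.All as All using (All; []; _∷_)
open import Data.List.Relation.Unary.AllPairs using ([]; _∷_)
open import Data.List.Relation.Unary.Unique.Propositional using (Unique)
open import Data.List.Relation.Unary.Unique.Propositional.Properties
  using (allFin⁺; take⁺; drop⁺)
import Data.List.Relation.Unary.Unique.Propositional.Properties as Unique
open import Data.List.Relation.Unary.Linked using (Linked; []; [-]; _∷_)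
import Data.List.Relation.Unary.Linked.Properties as Linked
open import Data.Maybe using (just)
open import Data.Maybe.Relation.Binary.Connected using (Connected; just)
open import Data.Product using (_×_; _,_; proj₁; ∃)
open import Data.Sum using (_⊎_; inj₁; inj₂)
open import Data.Empty using (⊥-elim)
open import Function using (_∘_; _on_)
open import Function.Bundles using (_⇔_; mk⇔)
open import Relation.Nullary using (yes; no)
open import Relation.Binary.Definitions using (tri<; tri≈; tri>)
open import Relation.Binary.PropositionalEquality
  using (_≡_; _≢_; refl; sym; trans; cong; cong₂; subst; setoid; module ≡-Reasoning)

private
  variable
    A : Set

applyUpTo-cong : ∀ {f g : ℕ → A} → (∀ i → f i ≡ g i) → ∀ k → applyUpTo f k ≡ applyUpTo g k
applyUpTo-cong f≗g zero    = refl
applyUpTo-cong f≗g (suc k) = cong₂ _∷_ (f≗g 0) (applyUpTo-cong (f≗g ∘ suc) k)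

applyUpTo-+ : ∀ (f : ℕ → A) m k → applyUpTo f (m + k) ≡ applyUpTo f m ++ applyUpTo (f ∘ (m +_)) k
applyUpTo-+ f zero    k = refl
applyUpTo-+ f (suc m) k = cong (f 0 ∷_) (applyUpTo-+ (f ∘ suc) m k)

applyUpTo-rotate : ∀ (f : ℕ → A) n → f n ≡ f 0 → applyUpTo (f ∘ suc) n ↭ applyUpTo f n
applyUpTo-rotate f zero    _     = ↭-refl
applyUpTo-rotate f (suc m) fn≡f0 = begin
  applyUpTo (f ∘ suc) (suc m)         ≡⟨ applyUpTo-∷ʳ (f ∘ suc) m ⟨
  applyUpTo (f ∘ suc) m ∷ʳ f (suc m)  ↭⟨ ∷↭∷ʳ (f (suc m)) _ ⟨
  f (suc m) ∷ applyUpTo (f ∘ suc) m   ≡⟨ cong (_∷ applyUpTo (f ∘ suc) m) fn≡f0 ⟩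
  applyUpTo f (suc m)                 ∎
  where open PermutationReasoning

last-applyUpTo : ∀ (f : ℕ → A) k → last (applyUpTo f (suc k)) ≡ just (f k)
last-applyUpTo f zero    = refl
last-applyUpTo f (suc k) = last-applyUpTo (f ∘ suc) k

last-applyDownFrom : ∀ (f : ℕ → A) k → last (applyDownFrom f (suc k)) ≡ just (f 0)
last-applyDownFrom f zero    = refl
last-applyDownFrom f (suc k) = last-applyDownFrom f k

map-close : ∀ {B : Set} (f : A → B) xs → map f (close xs) ≡ close (map f xs)
map-close f []       = refl
map-close f (x ∷ xs) = cong (f x ∷_) (map-++ f xs [ x ])

close-++ : ∀ (x : A) xs ys → close ((x ∷ xs) ++ ys) ≡ (x ∷ xs) ++ ys ++ [ x ]
close-++ x xs ys = cong (x ∷_) (++-assoc xs ys [ x ])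

Unique-resp-↭ : ∀ {xs ys : List A} → xs ↭ ys → Unique xs → Unique ys
Unique-resp-↭ {A = A} xs↭ys = Permutationₛ.Unique-resp-↭ (setoid A) (↭⇒↭ₛ xs↭ys)

Unique-++⇒disjoint : ∀ {x : A} xs {ys} → Unique (xs ++ ys) → x ∈ xs → x ∉ ys
Unique-++⇒disjoint (_ ∷ xs) (x∉xs++ys ∷ _) (here refl) x∈ys = All.lookup x∉xs++ys (∈-++⁺ʳ xs x∈ys) refl
Unique-++⇒disjoint (_ ∷ xs) (_ ∷ u)         (there x∈xs) = Unique-++⇒disjoint xs u x∈xs

-- Arithmetic modulo n

module _ {n : ℕ} .{{_ : NonZero n}} where

  toℕ-mod : ∀ i → toℕ (i mod n) ≡ i % n
  toℕ-mod i = toℕ-fromℕ< (m%n<n i n)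

  mod-cong : ∀ i j → i % n ≡ j % n → i mod n ≡ j mod n
  mod-cong i j eq = toℕ-injective (trans (toℕ-mod i) (trans eq (sym (toℕ-mod j))))

  mod-injective : ∀ i j → i mod n ≡ j mod n → i % n ≡ j % n
  mod-injective i j eq = trans (sym (toℕ-mod i)) (trans (cong toℕ eq) (toℕ-mod j))

  [m%n+k]%n≡[m+k]%n : ∀ m k → (m % n + k) % n ≡ (m + k) % n
  [m%n+k]%n≡[m+k]%n m k = begin
    (m % n + k) % n           ≡⟨ %-distribˡ-+ (m % n) k n ⟩
    (m % n % n + k % n) % n   ≡⟨ cong (λ x → (x + k % n) % n) (m%n%n≡m%n m n) ⟩
    (m % n + k % n) % n       ≡⟨ %-distribˡ-+ m k n ⟨
    (m + k) % n               ∎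
    where open ≡-Reasoning

  [k*[m%n]]%n≡[k*m]%n : ∀ k m → (k * (m % n)) % n ≡ (k * m) % n
  [k*[m%n]]%n≡[k*m]%n k m = begin
    (k * (m % n)) % n          ≡⟨ %-distribˡ-* k (m % n) n ⟩
    (k % n * (m % n % n)) % n  ≡⟨ cong (λ x → (k % n * x) % n) (m%n%n≡m%n m n) ⟩
    (k % n * (m % n)) % n      ≡⟨ %-distribˡ-* k m n ⟨
    (k * m) % n                ∎
    where open ≡-Reasoning

  *-cong-% : ∀ k {m o} → m % n ≡ o % n → (k * m) % n ≡ (k * o) % n
  *-cong-% k {m} {o} eq = begin
    (k * m) % n        ≡⟨ [k*[m%n]]%n≡[k*m]%n k m ⟨
    (k * (m % n)) % n  ≡⟨ cong (λ x → (k * x) % n) eq ⟩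
    (k * (o % n)) % n  ≡⟨ [k*[m%n]]%n≡[k*m]%n k o ⟩
    (k * o) % n        ∎
    where open ≡-Reasoning

  inverse-% : ∀ u w → (u * w) % n ≡ 1 % n → ∀ m → (u * (w * m)) % n ≡ m % n
  inverse-% u w uw≡1 m = begin
    (u * (w * m)) % n          ≡⟨ %-congˡ (*-assoc u w m) ⟨
    (u * w * m) % n            ≡⟨ %-distribˡ-* (u * w) m n ⟩
    ((u * w) % n * (m % n)) % n ≡⟨ cong (λ x → (x * (m % n)) % n) uw≡1 ⟩
    (1 % n * (m % n)) % n      ≡⟨ %-distribˡ-* 1 m n ⟨
    (1 * m) % n                ≡⟨ %-congˡ (*-identityˡ m) ⟩
    m % n                      ∎
    where open ≡-Reasoning

stepBy-mod : ∀ {m} d i j → (i + d) % suc m ≡ j % suc m →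
             StepBy (suc m) d (i mod suc m) (j mod suc m)
stepBy-mod {m} d i j eq = begin
  (toℕ (i mod suc m) + d) % suc m  ≡⟨ cong (λ x → (x + d) % suc m) (toℕ-mod i) ⟩
  (i % suc m + d) % suc m          ≡⟨ [m%n+k]%n≡[m+k]%n i d ⟩
  (i + d) % suc m                  ≡⟨ eq ⟩
  j % suc m                        ≡⟨ toℕ-mod j ⟨
  toℕ (j mod suc m)                ∎
  where open ≡-Reasoning

-- Separating 2-factors

module _ {n : ℕ} {C D : List (Fin n)} {a b : Fin n} where

  separates-pair : (∀ {x} → x ∈ C → x ∉ D) → a ∈ C → b ∈ D →
                   Separates (C ∷ D ∷ []) (a ∷ b ∷ [])
  separates-pair C∩D≡∅ a∈C b∈D = refl , meetsC ∷ meetsD ∷ []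
    where
    meetsC : MeetsOnce (a ∷ b ∷ []) C
    meetsC = (a , here refl , a∈C) , λ where
      (here refl)         _   (here refl)         _   → refl
      (here refl)         _   (there (here refl)) b∈C → ⊥-elim (C∩D≡∅ b∈C b∈D)
      (there (here refl)) b∈C _                   _   → ⊥-elim (C∩D≡∅ b∈C b∈D)
    meetsD : MeetsOnce (a ∷ b ∷ []) D
    meetsD = (b , there (here refl) , b∈D) , λ where
      (there (here refl)) _   (there (here refl)) _   → refl
      (there (here refl)) _   (here refl)         a∈D → ⊥-elim (C∩D≡∅ a∈C a∈D)
      (here refl)         a∈D _                   _   → ⊥-elim (C∩D≡∅ a∈C a∈D)

separates-swap : ∀ {n} {cs : List (List (Fin n))} {a b} →
                 Separates cs (a ∷ b ∷ []) → Separates cs (b ∷ a ∷ [])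
separates-swap {n} {a = a} {b} (len , meets) = len , All.map swapMeets meets
  where
  swap∈ : ∀ {x y z : Fin n} → x ∈ y ∷ z ∷ [] → x ∈ z ∷ y ∷ []
  swap∈ (here x≡y)         = there (here x≡y)
  swap∈ (there (here x≡z)) = here x≡z
  swapMeets : ∀ {c} → MeetsOnce (a ∷ b ∷ []) c → MeetsOnce (b ∷ a ∷ []) c
  swapMeets ((x , x∈A , x∈c) , once) =
    (x , swap∈ x∈A , x∈c) , λ y∈A y∈c z∈A z∈c → once (swap∈ y∈A) y∈c (swap∈ z∈A) z∈c

3*length≤length-concat : ∀ {xss : List (List A)} → All (λ xs → 3 ≤ length xs) xss →
                          3 * length xss ≤ length (concat xss)
3*length≤length-concat []                                 = z≤n
3*length≤length-concat {xss = xs ∷ xss} (3≤|xs| ∷ 3≤|xss|) = begin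
  3 * suc (length xss)             ≡⟨ *-suc 3 (length xss) ⟩
  3 + 3 * length xss               ≤⟨ +-mono-≤ 3≤|xs| (3*length≤length-concat 3≤|xss|) ⟩
  length xs + length (concat xss)  ≡⟨ length-++ xs ⟨
  length (xs ++ concat xss)        ∎
  where open ≤-Reasoning

length-take-allFin : ∀ {k n} → k ≤ n → length (take k (allFin n)) ≡ k
length-take-allFin {k} {n} k≤n =
  trans (length-take k (allFin n)) (trans (cong (k ⊓_) (length-tabulate _)) (m≤n⇒m⊓n≡m k≤n))

spanningCyclable⇒3k≤n : ∀ {k n s} → k ≤ n → SpanningCyclable k n s → 3 * k ≤ n
spanningCyclable⇒3k≤n {k} {n} k≤n cyclable
  with cyclable (take k (allFin n)) (take⁺ k (allFin⁺ n)) (length-take-allFin k≤n)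
... | cs , (cycles , cs↭V) , (|cs|≡|A| , _) = begin
  3 * k               ≡⟨ cong (3 *_) (trans |cs|≡|A| (length-take-allFin k≤n)) ⟨
  3 * length cs       ≤⟨ 3*length≤length-concat (All.map proj₁ cycles) ⟩
  length (concat cs)  ≡⟨ ↭-length cs↭V ⟩
  length (allFin n)   ≡⟨ length-tabulate _ ⟩
  n                   ∎
  where open ≤-Reasoning

-- Spanning copies of circ(n;±1,±t)

circAdj-sym : ∀ {n s x y} → circAdj n s x y → circAdj n s y x
circAdj-sym (inj₁ x+1≡y)               = inj₂ (inj₁ x+1≡y)
circAdj-sym (inj₂ (inj₁ y+1≡x))        = inj₁ y+1≡x
circAdj-sym (inj₂ (inj₂ (inj₁ x+s≡y))) = inj₂ (inj₂ (inj₂ x+s≡y))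
circAdj-sym (inj₂ (inj₂ (inj₂ y+s≡x))) = inj₂ (inj₂ (inj₁ y+s≡x))

-- vertex i is the image of the vertex u_i (i read modulo n) of circ(n;±1,±t).
record SpanningCirc (n s t : ℕ) : Set where
  field
    vertex     : ℕ → Fin n
    periodic   : ∀ i → vertex (i + n) ≡ vertex i
    enumerates : applyUpTo vertex n ↭ allFin n
    adj-suc    : ∀ i → circAdj n s (vertex i) (vertex (suc i))
    adj-+t     : ∀ i → circAdj n s (vertex i) (vertex (i + t))

open SpanningCirc

module _ {n s t : ℕ} where

  rotate₁ : SpanningCirc n s t → SpanningCirc n s t
  rotate₁ L = record
    { vertex     = vertex L ∘ suc
    ; periodic   = periodic L ∘ suc
    ; enumerates = ↭-trans (applyUpTo-rotate (vertex L) n (periodic L 0)) (enumerates L)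
    ; adj-suc    = adj-suc L ∘ suc
    ; adj-+t     = adj-+t L ∘ suc
    }

  rotate : ℕ → SpanningCirc n s t → SpanningCirc n s t
  rotate zero    L = L
  rotate (suc p) L = rotate p (rotate₁ L)

  vertex-rotate : ∀ p L i → vertex (rotate p L) i ≡ vertex L (p + i)
  vertex-rotate zero    L i = refl
  vertex-rotate (suc p) L i = vertex-rotate p (rotate₁ L) i

module Scaling {m s t : ℕ} (u w : ℕ) (uw≡1 : (u * w) % suc m ≡ 1 % suc m) where

  private
    n = suc m

  scale : ℕ → Fin n
  scale i = (u * i) mod n

  scale-periodic : ∀ i → scale (i + n) ≡ scale i
  scale-periodic i = mod-cong (u * (i + n)) (u * i)
    (trans (%-congˡ (*-distribˡ-+ u i n)) ([m+kn]%n≡m%n (u * i) u n))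

  scale-injective : ∀ {i j} → i < n → j < n → scale i ≡ scale j → i ≡ j
  scale-injective {i} {j} i<n j<n eq = begin
    i                  ≡⟨ m<n⇒m%n≡m i<n ⟨
    i % n              ≡⟨ inverse-% w u wu≡1 i ⟨
    (w * (u * i)) % n  ≡⟨ *-cong-% w (mod-injective (u * i) (u * j) eq) ⟩
    (w * (u * j)) % n  ≡⟨ inverse-% w u wu≡1 j ⟩
    j % n              ≡⟨ m<n⇒m%n≡m j<n ⟩
    j                  ∎
    where
    open ≡-Reasoning
    wu≡1 : (w * u) % n ≡ 1 % n
    wu≡1 = trans (%-congˡ (*-comm w u)) uw≡1

  scale-inverse : ∀ y → scale ((w * toℕ y) % n) ≡ y
  scale-inverse y = toℕ-injective (begin
    toℕ (scale ((w * toℕ y) % n))  ≡⟨ toℕ-mod (u * ((w * toℕ y) % n)) ⟩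
    (u * ((w * toℕ y) % n)) % n    ≡⟨ [k*[m%n]]%n≡[k*m]%n u (w * toℕ y) ⟩
    (u * (w * toℕ y)) % n          ≡⟨ inverse-% u w uw≡1 (toℕ y) ⟩
    toℕ y % n                      ≡⟨ m<n⇒m%n≡m (toℕ<n y) ⟩
    toℕ y                          ∎)
    where open ≡-Reasoning

  scale-enumerates : applyUpTo scale n ↭ allFin n
  scale-enumerates = ∼bag⇒↭ (unique∧set⇒bag distinct (allFin⁺ n) (mk⇔ (λ _ → ∈-allFin _) covers))
    where
    distinct : Unique (applyUpTo scale n)
    distinct = Unique.applyUpTo⁺₁ scale n
      (λ i<j j<n → <⇒≢ i<j ∘ scale-injective (<-trans i<j j<n) j<n)
    covers : ∀ {y} → y ∈ allFin n → y ∈ applyUpTo scale n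
    covers {y} _ = subst (_∈ _) (scale-inverse y) (∈-applyUpTo⁺ scale (m%n<n (w * toℕ y) n))

  scaledCirc : (∀ i → circAdj n s (scale i) (scale (suc i))) →
               (∀ i → circAdj n s (scale i) (scale (i + t))) → SpanningCirc n s t
  scaledCirc adj-suc adj-+t = record
    { vertex     = scale
    ; periodic   = scale-periodic
    ; enumerates = scale-enumerates
    ; adj-suc    = adj-suc
    ; adj-+t     = adj-+t
    }

circ-identity : ∀ {m s} → SpanningCirc (suc m) s s
circ-identity {m} {s} = scaledCirc adj-suc′ adj-+s
  where
  open Scaling {m} 1 1 refl
  1*i+1≡1*[1+i] : ∀ i → 1 * i + 1 ≡ 1 * suc i
  1*i+1≡1*[1+i] = solve-∀
  1*i+s≡1*[i+s] : ∀ i s → 1 * i + s ≡ 1 * (i + s)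
  1*i+s≡1*[i+s] = solve-∀
  adj-suc′ : ∀ i → circAdj (suc m) s (scale i) (scale (suc i))
  adj-suc′ i = inj₁ (stepBy-mod 1 (1 * i) (1 * suc i) (cong (_% suc m) (1*i+1≡1*[1+i] i)))
  adj-+s : ∀ i → circAdj (suc m) s (scale i) (scale (i + s))
  adj-+s i = inj₂ (inj₂ (inj₁ (stepBy-mod s (1 * i) (1 * (i + s)) (cong (_% suc m) (1*i+s≡1*[i+s] i s)))))

-- Doubling turns steps by 1 into steps by 2 and, as 2t ≡ -1 modulo 2t + 1, steps by t into
-- steps by -1.
circ-doubling : ∀ {t} → SpanningCirc (suc (2 * t)) 2 t
circ-doubling {t} = scaledCirc adj-suc′ adj-+t′
  where
  n = suc (2 * t)
  2*[1+t]≡1+n : ∀ t → 2 * suc t ≡ 1 + suc (2 * t)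
  2*[1+t]≡1+n = solve-∀
  2*[i+1]≡2*i+2 : ∀ i → 2 * i + 2 ≡ 2 * suc i
  2*[i+1]≡2*i+2 = solve-∀
  2*[i+t]+1≡2*i+n : ∀ i t → 2 * (i + t) + 1 ≡ 2 * i + suc (2 * t)
  2*[i+t]+1≡2*i+n = solve-∀
  open Scaling {2 * t} 2 (suc t) (trans (cong (_% n) (2*[1+t]≡1+n t)) ([m+n]%n≡m%n 1 n))
  adj-suc′ : ∀ i → circAdj n 2 (scale i) (scale (suc i))
  adj-suc′ i = inj₂ (inj₂ (inj₁ (stepBy-mod 2 (2 * i) (2 * suc i) (cong (_% n) (2*[i+1]≡2*i+2 i)))))
  adj-+t′ : ∀ i → circAdj n 2 (scale i) (scale (i + t))
  adj-+t′ i = inj₂ (inj₁ (stepBy-mod 1 (2 * (i + t)) (2 * i)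
    (trans (cong (_% n) (2*[i+t]+1≡2*i+n i t)) ([m+n]%n≡m%n (2 * i) n))))

-- The square-and-remainder 2-factors

-- With t = 3 + q and n = 2t + 1 + e, the remainder cycle climbs the ascent t+2, …, n-1, steps
-- by t to t-1 (modulo n), descends t-1, …, 2 and steps by t back to t+2.
module SquareFactor (q e : ℕ) where

  t r n : ℕ
  t = 3 + q
  r = 2 + q + e
  n = suc (2 * t) + e

  squareOffsets ascent descent remainderOffsets : List ℕ
  squareOffsets    = 0 ∷ 1 ∷ suc t ∷ t ∷ []
  ascent           = applyUpTo (λ i → 2 + i + t) r
  descent          = applyDownFrom (2 +_) (suc q)
  remainderOffsets = ascent ++ descent

  private
    n≡2+[1+q]+[2+r] : ∀ q e → suc (2 * (3 + q)) + e ≡ 2 + (suc q + (2 + (2 + q + e)))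
    n≡2+[1+q]+[2+r] = solve-∀
    2+[1+q+i]≡i+t : ∀ q i → 2 + (suc q + i) ≡ i + (3 + q)
    2+[1+q+i]≡i+t = solve-∀
    n-1+t≡t-1+n : ∀ q e → 2 + suc (q + e) + (3 + q) + (3 + q) ≡ 2 + q + (suc (2 * (3 + q)) + e)
    n-1+t≡t-1+n = solve-∀

  offsets-↭ : squareOffsets ++ remainderOffsets ↭ upTo n
  offsets-↭ = begin
    0 ∷ 1 ∷ suc t ∷ t ∷ ascent ++ descent
      ↭⟨ ↭-prep 0 (↭-prep 1 (↭-swap (suc t) t ↭-refl)) ⟩
    0 ∷ 1 ∷ (t ∷ suc t ∷ ascent) ++ descent
      ↭⟨ ↭-prep 0 (↭-prep 1 (++-comm (t ∷ suc t ∷ ascent) descent)) ⟩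
    0 ∷ 1 ∷ descent ++ t ∷ suc t ∷ ascent
      ↭⟨ ↭-prep 0 (↭-prep 1 (++⁺ʳ _ descent↭)) ⟩
    0 ∷ 1 ∷ applyUpTo (2 +_) (suc q) ++ applyUpTo (_+ t) (2 + r)
      ≡⟨ cong (λ xs → 0 ∷ 1 ∷ applyUpTo (2 +_) (suc q) ++ xs)
              (applyUpTo-cong (2+[1+q+i]≡i+t q) (2 + r)) ⟨
    0 ∷ 1 ∷ applyUpTo (2 +_) (suc q) ++ applyUpTo ((2 +_) ∘ (suc q +_)) (2 + r)
      ≡⟨ cong (λ xs → 0 ∷ 1 ∷ xs) (applyUpTo-+ (2 +_) (suc q) (2 + r)) ⟨
    upTo (2 + (suc q + (2 + r)))
      ≡⟨ cong upTo (n≡2+[1+q]+[2+r] q e) ⟨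
    upTo n ∎
    where
    open PermutationReasoning
    descent↭ : descent ↭ applyUpTo (2 +_) (suc q)
    descent↭ = ↭-trans (↭-reflexive (sym (reverse-applyUpTo (2 +_) (suc q)))) (↭-reverse _)

  ∈-remainderOffsets : ∀ {o} → o < n → o ∉ squareOffsets → o ∈ remainderOffsets
  ∈-remainderOffsets o<n o∉square
    with ∈-++⁻ squareOffsets (∈-resp-↭ (↭-sym offsets-↭) (∈-upTo⁺ o<n))
  ... | inj₁ o∈square    = ⊥-elim (o∉square o∈square)
  ... | inj₂ o∈remainder = o∈remainder

  module _ {s : ℕ} where

    square remainder : SpanningCirc n s t → List (Fin n)
    square    L = map (vertex L) squareOffsets
    remainder L = map (vertex L) remainderOffsets

    vertices-↭ : ∀ L → square L ++ remainder L ↭ allFin n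
    vertices-↭ L = begin
      square L ++ remainder L                             ≡⟨ map-++ (vertex L) squareOffsets remainderOffsets ⟨
      map (vertex L) (squareOffsets ++ remainderOffsets)  ↭⟨ map⁺ (vertex L) offsets-↭ ⟩
      map (vertex L) (upTo n)                             ≡⟨ map-upTo (vertex L) n ⟩
      applyUpTo (vertex L) n                              ↭⟨ enumerates L ⟩
      allFin n                                            ∎
      where open PermutationReasoning

    vertices-unique : ∀ L → Unique (square L ++ remainder L)
    vertices-unique L = Unique-resp-↭ (↭-sym (vertices-↭ L)) (allFin⁺ n)

    square-isCycle : ∀ L → IsCycle n s (square L)
    square-isCycle L = s≤s (s≤s (s≤s z≤n)) , take⁺ 4 (vertices-unique L) ,
      adj-suc L 0 ∷ adj-+t L 1 ∷ circAdj-sym (adj-suc L t) ∷ circAdj-sym (adj-+t L 0) ∷ [-]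

    length-remainder : ∀ L → length (remainder L) ≡ r + suc q
    length-remainder L = begin
      length (remainder L)            ≡⟨ length-map (vertex L) remainderOffsets ⟩
      length (ascent ++ descent)      ≡⟨ length-++ ascent ⟩
      length ascent + length descent  ≡⟨ cong₂ _+_ (length-applyUpTo (λ i → 2 + i + t) r)
                                                   (length-applyDownFrom (2 +_) (suc q)) ⟩
      r + suc q                       ∎
      where open ≡-Reasoning

    remainderOffsets-closed : ∀ L → Linked (circAdj n s on vertex L) (close remainderOffsets)
    remainderOffsets-closed L =
      subst (Linked Adj) (sym (close-++ (2 + t) (applyUpTo (λ i → 3 + i + t) (suc (q + e))) descent))
        (Linked.++⁺ (Linked.applyUpTo⁺₂ (λ i → 2 + i + t) r (λ i → adj-suc L (2 + i + t))) top
          (Linked.++⁺ (Linked.applyDownFrom⁺₂ (2 +_) (suc q) (λ i → circAdj-sym (adj-suc L (2 + i))))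
                      bottom [-]))
      where
      Adj : ℕ → ℕ → Set
      Adj = circAdj n s on vertex L
      top : Connected Adj (last ascent) (just (2 + q))
      top = subst (λ x → Connected Adj x (just (2 + q)))
        (sym (last-applyUpTo (λ i → 2 + i + t) (suc (q + e))))
        (just (subst (circAdj n s (vertex L _))
                     (trans (cong (vertex L) (n-1+t≡t-1+n q e)) (periodic L (2 + q)))
                     (adj-+t L _)))
      bottom : Connected Adj (last descent) (just (2 + t))
      bottom = subst (λ x → Connected Adj x (just (2 + t))) (sym (last-applyDownFrom (2 +_) q))
        (just (adj-+t L 2))

    remainder-isCycle : ∀ L → IsCycle n s (remainder L)
    remainder-isCycle L =
      subst (3 ≤_) (sym (length-remainder L)) (+-mono-≤ {2} {r} {1} (s≤s (s≤s z≤n)) (s≤s z≤n)) ,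
      drop⁺ 4 (vertices-unique L) ,
      subst (Linked _) (map-close (vertex L) remainderOffsets) (Linked.map⁺ (remainderOffsets-closed L))

    isTwoFactor : ∀ L → Is2Factor n s (square L ∷ remainder L ∷ [])
    isTwoFactor L = (square-isCycle L ∷ remainder-isCycle L ∷ []) ,
      ↭-trans (↭-reflexive (cong (square L ++_) (++-identityʳ (remainder L)))) (vertices-↭ L)

    module _ (L : SpanningCirc n s t) where

      Split : ℕ → Fin n → Fin n → Set
      Split p a b = let L′ = rotate p L in
        (a ∈ square L′ × b ∈ remainder L′) ⊎ (b ∈ square L′ × a ∈ remainder L′)

      private
        1+α+[n-1]≡α+n : ∀ α q e → suc α + (2 + suc (q + e) + (3 + q)) ≡ α + (suc (2 * (3 + q)) + e)
        1+α+[n-1]≡α+n = solve-∀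
        α+[t-1]+1≡α+t : ∀ α q → α + (2 + q) + 1 ≡ suc α + (2 + q)
        α+[t-1]+1≡α+t = solve-∀
        α+[t-1]+[n-t+1]≡α+n : ∀ α q e → α + (2 + q) + (2 + e + (3 + q)) ≡ α + (suc (2 * (3 + q)) + e)
        α+[t-1]+[n-t+1]≡α+n = solve-∀

      at : ∀ p {o x} (O : List ℕ) → o ∈ O → vertex L (p + o) ≡ vertex L x →
           vertex L x ∈ map (vertex (rotate p L)) O
      at p O o∈O eq = subst (_∈ _) (trans (vertex-rotate p L _) eq) (∈-map⁺ (vertex (rotate p L)) o∈O)

      wrapped : ∀ {y x} → y ≡ x + n → vertex L y ≡ vertex L x
      wrapped {x = x} refl = periodic L x

      previous∈remainder : ∀ α → vertex L α ∈ remainder (rotate (suc α) L)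
      previous∈remainder α = at (suc α) remainderOffsets
        (∈-++⁺ˡ (∈-applyUpTo⁺ (λ i → 2 + i + t) {suc (q + e)} ≤-refl)) (wrapped (1+α+[n-1]≡α+n α q e))

      -- For a difference δ = 1 + d: δ = 1 and δ = t + 1 place β at offsets 0 and t and α at offset
      -- n - 1 of the rotation by α + 1; δ = t places β at offset 1 and α at offset n - t + 1 of the
      -- rotation by α + t - 1, which lies on the ascent because 2t < n; any other δ < n is itself
      -- an offset of the remainder.
      split : ∀ α d → suc α + d < n → ∃ λ p → Split p (vertex L α) (vertex L (suc α + d))
      split α zero _ = suc α , inj₂ (at (suc α) squareOffsets (here refl) refl , previous∈remainder α)
      split α (suc d) β<n with suc d ≟ 2 + q | suc d ≟ 3 + q
      ... | yes refl | _ = α + (2 + q) , inj₂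
        ( at (α + (2 + q)) squareOffsets (there (here refl)) (cong (vertex L) (α+[t-1]+1≡α+t α q))
        , at (α + (2 + q)) remainderOffsets
             (∈-++⁺ˡ (∈-applyUpTo⁺ (λ i → 2 + i + t) {e} (m<n+m e {2 + q} (s≤s z≤n))))
             (wrapped (α+[t-1]+[n-t+1]≡α+n α q e)))
      ... | no _ | yes refl = suc α , inj₂
        (at (suc α) squareOffsets (there (there (there (here refl)))) refl , previous∈remainder α)
      ... | no δ≢t | no δ≢t+1 = α , inj₁
        ( at α squareOffsets (here refl) (cong (vertex L) (+-identityʳ α))
        , at α remainderOffsets (∈-remainderOffsets δ<n δ∉square) (cong (vertex L) (+-suc α (suc d))))
        where
        δ<n : suc (suc d) < n
        δ<n = ≤-trans (s≤s (s≤s (m≤n+m (suc d) α))) β<n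
        δ∉square : suc (suc d) ∉ squareOffsets
        δ∉square (there (there (here eq)))         = δ≢t+1 (suc-injective eq)
        δ∉square (there (there (there (here eq)))) = δ≢t (suc-injective eq)

      square-disjoint : ∀ p {x} → x ∈ square (rotate p L) → x ∉ remainder (rotate p L)
      square-disjoint p = Unique-++⇒disjoint (square (rotate p L)) (vertices-unique (rotate p L))

      separated : ∀ p {a b} → Split p a b → ∃ λ cs → Is2Factor n s cs × Separates cs (a ∷ b ∷ [])
      separated p (inj₁ (a∈square , b∈remainder)) =
        _ , isTwoFactor (rotate p L) , separates-pair (square-disjoint p) a∈square b∈remainder
      separated p (inj₂ (b∈square , a∈remainder)) =
        _ , isTwoFactor (rotate p L) ,
        separates-swap (separates-pair (square-disjoint p) b∈square a∈remainder)

      separated-< : ∀ {α β} → α < β → β < n →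
                    ∃ λ cs → Is2Factor n s cs × Separates cs (vertex L α ∷ vertex L β ∷ [])
      separated-< {α} α<β β<n with m≤n⇒∃[o]m+o≡n α<β
      ... | d , refl = let p , α|β = split α d β<n in separated p α|β

      spanningCyclable : SpanningCyclable 2 n s
      spanningCyclable []              _                ()
      spanningCyclable (_ ∷ [])        _                ()
      spanningCyclable (_ ∷ _ ∷ _ ∷ _) _                ()
      spanningCyclable (a ∷ b ∷ [])    ((a≢b ∷ []) ∷ _) refl
        with ∈-applyUpTo⁻ (vertex L) (∈-resp-↭ (↭-sym (enumerates L)) (∈-allFin a))
           | ∈-applyUpTo⁻ (vertex L) (∈-resp-↭ (↭-sym (enumerates L)) (∈-allFin b))
      ... | α , α<n , refl | β , β<n , refl with <-cmp α β
      ... | tri< α<β _ _  = separated-< α<β β<n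
      ... | tri≈ _ refl _ = ⊥-elim (a≢b refl)
      ... | tri> _ _ β<α with separated-< β<α α<n
      ...   | cs , factor , separates = cs , factor , separates-swap separates

spanningCirc⇒2-spanningCyclable : ∀ {n s t} → 3 ≤ t → 2 * t < n → SpanningCirc n s t →
                                   SpanningCyclable 2 n s
spanningCirc⇒2-spanningCyclable 3≤t 2t<n L with m≤n⇒∃[o]m+o≡n 3≤t
... | q , refl with m≤n⇒∃[o]m+o≡n 2t<n
... | e , refl = SquareFactor.spanningCyclable q e L

coprime-2⇒odd : ∀ {n} → Coprime n 2 → ∃ λ t → n ≡ suc (2 * t)
coprime-2⇒odd {n} coprime with n % 2 | m%n<n n 2 | m≡m%n+[m/n]*n n 2
... | 0           | _            | n≡2k   with () ← coprime (divides (n / 2) n≡2k , ∣-refl)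
... | 1           | _            | n≡2k+1 = n / 2 , trans n≡2k+1 (cong suc (*-comm (n / 2) 2))
... | suc (suc _) | s≤s (s≤s ()) | _

coprime⇒2-spanningCyclable : ∀ {n s} → 2 ≤ s → 2 * s ≤ n → Coprime n s → 6 ≤ n →
                             SpanningCyclable 2 n s
coprime⇒2-spanningCyclable {s = 0}                     ()
coprime⇒2-spanningCyclable {s = 1}                     (s≤s ())
coprime⇒2-spanningCyclable {zero}  {suc (suc _)}       _ () _ _
coprime⇒2-spanningCyclable {suc m} {2}                 _ _ coprime 6≤n with coprime-2⇒odd coprime
... | t , refl = spanningCirc⇒2-spanningCyclable (*-cancelˡ-< 2 2 t (s≤s⁻¹ 6≤n)) ≤-refl circ-doubling
coprime⇒2-spanningCyclable {suc m} {s@(suc (suc (suc _)))} _ 2s≤n coprime _ =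
  spanningCirc⇒2-spanningCyclable (s≤s (s≤s (s≤s z≤n))) (≤∧≢⇒< 2s≤n 2s≢n) circ-identity
  where
  2s≢n : 2 * s ≢ suc m
  2s≢n 2s≡n with () ← coprime (divides 2 (sym 2s≡n) , ∣-refl)

theorem5p1 : (n s : ℕ) → 2 ≤ s → 2 * s ≤ n → gcd n s ≡ 1 →
    (SpanningCyclable 2 n s ⇔ 6 ≤ n)
theorem5p1 n s 2≤s 2s≤n gcd≡1 =
  mk⇔ (spanningCyclable⇒3k≤n 2≤n) (coprime⇒2-spanningCyclable 2≤s 2s≤n (gcd≡1⇒coprime gcd≡1))
  where
  2≤n : 2 ≤ n
  2≤n = ≤-trans 2≤s (≤-trans (m≤n*m s 2) 2s≤n)
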